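{- Let $\mu=\frac{ -1+\sqrt7 i}{2}$ and $\bar\mu=\frac{ -1-\sqrt7 i}{2}$. For every $r\ge0$, $$T(2^r;3,0) = \frac14\cdot 2^r + \left(\frac{7-\sqrt7 i}{56}\right)\mu^r + \left(\frac{7+\sqrt7 i}{56}\right)\bar\mu^r + \frac12.$$
   Context: The Stern sequence $(s(n))_{n\ge0}$ is defined by $s(0)=0$, $s(1)=1$, $s(2n)=s(n)$, $s(2n+1)=s(n)+s(n+1)$. For integers $N\ge1$, $d\ge2$ and $0\le i<d$, let $T(N;d,i)=|\{n: 0\le n<N,\ s(n)\equiv i \pmod d\}|$. -}

module Defs where

open import Data.Nat as ℕ using (ℕ; zero; suc; ⌊_/2⌋; _%_; _≟_; _^_)
open import Data.Integer using (+_; -[1+_])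
open import Data.Rational as ℚ using (ℚ; _/_)
open import Data.Product using (_×_; _,_)
open import Data.List using (List; filter; length; upTo)

-- Stern's diatomic sequence, defined with fuel (fuel n+1 suffices for argument n).
sternF : ℕ → ℕ → ℕ
sternF zero _ = 0
sternF (suc k) zero = 0
sternF (suc k) (suc zero) = 1
sternF (suc k) n@(suc (suc _)) with n % 2
... | zero = sternF k ⌊ n /2⌋
... | suc _ = sternF k ⌊ n /2⌋ ℕ.+ sternF k (suc ⌊ n /2⌋)

stern : ℕ → ℕ
stern n = sternF (suc n) n

T : ℕ → (d : ℕ) → .{{ℕ.NonZero d}} → ℕ → ℕ
T N d i = length (filter (λ n → (stern n % d) ≟ (i % d)) (upTo N))

-- The field ℚ(√7 i): a pair (a , b) denotes a + b·√7 i, where (√7 i)² = -7.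
Q7 : Set
Q7 = ℚ × ℚ

infixl 6 _⊕_
infixl 7 _⊗_

_⊕_ : Q7 → Q7 → Q7
(a , b) ⊕ (c , d) = (a ℚ.+ c , b ℚ.+ d)

_⊗_ : Q7 → Q7 → Q7
(a , b) ⊗ (c , d) = (a ℚ.* c ℚ.- (+ 7 / 1) ℚ.* (b ℚ.* d) , a ℚ.* d ℚ.+ b ℚ.* c)

_^Q_ : Q7 → ℕ → Q7
x ^Q zero = (ℚ.1ℚ , ℚ.0ℚ)
x ^Q suc n = x ⊗ (x ^Q n)

ofℚ : ℚ → Q7
ofℚ q = (q , ℚ.0ℚ)

ofℕ : ℕ → Q7
ofℕ n = ofℚ (+ n / 1)

√7i : Q7
√7i = (ℚ.0ℚ , ℚ.1ℚ)

μ : Q7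
μ = (-[1+ 0 ] / 2 , + 1 / 2)

μ̄ : Q7
μ̄ = (-[1+ 0 ] / 2 , -[1+ 0 ] / 2)

c₁ : Q7
c₁ = (+ 7 / 56 , -[1+ 0 ] / 56)

c₂ : Q7
c₂ = (+ 7 / 56 , + 1 / 56)

{-# OPTIONS --safe #-}
-- The values s(2^k n + j), j ≤ 2^k, arise from s(n) and s(n+1) by inserting mediants k times
-- (Stern's diatomic array), so the number of j < 2^k with 3 ∣ s(2^k n + j) depends only on
-- (s(n), s(n+1)) mod 3. Splitting a row into its two halves gives a linear recursion in k for these
-- counts over the eight nonzero residue pairs, solved by 4·count = 2^k + α + β P_k + γ Q_k where
-- μ^k = P_k + Q_k μ. T(2^r;3,0) is the count for (s(0), s(1)) = (0, 1), so 4 T(2^r;3,0) = 2^r + 2 + P_r,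
-- and the right-hand side is the same number because c₁ μ^r + c₂ μ̄^r = P_r / 4.
module Submission where

open import Defs
open import Data.Nat using (ℕ; _^_)
open import Data.Integer using (+_)
open import Data.Rational using (_/_)
open import Relation.Binary.PropositionalEquality using (_≡_)

module SternBlocks where

  open import Function using (_∘_; id)
  open import Data.Nat
    using (zero; suc; _+_; _*_; _%_; _<_; ⌊_/2⌋; s≤s; NonZero; _≟_)
  open import Data.Nat.Properties
    using (≤-refl; ≤-trans; <⇒≤; m≤n⇒m≤1+n; m≤m*n; ⌊n/2⌋<n; +-assoc; +-identityʳ; *-identityˡ; *-zeroʳ)
  open import Data.Nat.DivMod using (m*n%n≡0; [m+kn]%n≡m%n; %-distribˡ-+; m%n%n≡m%n)
  open import Data.Nat.Tactic.RingSolver using (solve-∀)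
  open import Data.Bool using (true; false; if_then_else_)
  open import Data.List using (applyUpTo; filter; length)
  open import Relation.Nullary using (does)
  open import Relation.Unary using (Pred; Decidable)
  open import Relation.Binary.PropositionalEquality
    using (refl; sym; trans; cong; cong₂; _≗_; module ≡-Reasoning)

  suc⌊n/2⌋<n : ∀ n → suc ⌊ 3 + n /2⌋ < 3 + n
  suc⌊n/2⌋<n n = s≤s (s≤s (⌊n/2⌋<n n))

  sternF-stable : ∀ {j k} n → n < j → n < k → sternF j n ≡ sternF k n
  sternF-stable {suc j} {suc k} 0 _ _ = refl
  sternF-stable {suc j} {suc k} 1 _ _ = refl
  sternF-stable 2 (s≤s (s≤s (s≤s _))) (s≤s (s≤s (s≤s _))) = refl
  sternF-stable {suc j} {suc k} (suc (suc (suc m))) (s≤s p) (s≤s q) with suc m % 2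
  ... | zero  = sternF-stable _ (≤-trans (<⇒≤ (suc⌊n/2⌋<n m)) p) (≤-trans (<⇒≤ (suc⌊n/2⌋<n m)) q)
  ... | suc _ = cong₂ _+_
    (sternF-stable _ (≤-trans (<⇒≤ (suc⌊n/2⌋<n m)) p) (≤-trans (<⇒≤ (suc⌊n/2⌋<n m)) q))
    (sternF-stable _ (≤-trans (suc⌊n/2⌋<n m) p) (≤-trans (suc⌊n/2⌋<n m) q))

  sternF≡stern : ∀ {k} n → n < k → sternF k n ≡ stern n
  sternF≡stern n n<k = sternF-stable n n<k (s≤s ≤-refl)

  ⌊n*2/2⌋≡n : ∀ n → ⌊ n * 2 /2⌋ ≡ n
  ⌊n*2/2⌋≡n zero    = refl
  ⌊n*2/2⌋≡n (suc n) = cong suc (⌊n*2/2⌋≡n n)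

  ⌊1+n*2/2⌋≡n : ∀ n → ⌊ suc (n * 2) /2⌋ ≡ n
  ⌊1+n*2/2⌋≡n zero    = refl
  ⌊1+n*2/2⌋≡n (suc n) = cong suc (⌊1+n*2/2⌋≡n n)

  stern-even : ∀ n → stern (n * 2) ≡ stern n
  stern-even zero = refl
  stern-even (suc n) rewrite m*n%n≡0 n 2 ⦃ _ ⦄ | ⌊n*2/2⌋≡n n =
    sternF≡stern (suc n) (s≤s (s≤s (m≤m*n n 2)))

  stern-odd : ∀ n → stern (suc (n * 2)) ≡ stern n + stern (suc n)
  stern-odd zero = refl
  stern-odd (suc n) rewrite [m+kn]%n≡m%n 1 n 2 ⦃ _ ⦄ | ⌊1+n*2/2⌋≡n n =
    cong₂ _+_ (sternF≡stern (suc n) (s≤s (s≤s (m≤n⇒m≤1+n (m≤m*n n 2)))))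
              (sternF≡stern (suc (suc n)) (s≤s (s≤s (s≤s (m≤m*n n 2)))))

  sumUpTo : (ℕ → ℕ) → ℕ → ℕ
  sumUpTo f zero    = 0
  sumUpTo f (suc n) = f 0 + sumUpTo (f ∘ suc) n

  sumUpTo-cong : ∀ {f g} → f ≗ g → ∀ n → sumUpTo f n ≡ sumUpTo g n
  sumUpTo-cong f≗g zero    = refl
  sumUpTo-cong f≗g (suc n) = cong₂ _+_ (f≗g 0) (sumUpTo-cong (f≗g ∘ suc) n)

  sumUpTo-+ : ∀ f m n → sumUpTo f (m + n) ≡ sumUpTo f m + sumUpTo (λ j → f (m + j)) n
  sumUpTo-+ f zero    n = refl
  sumUpTo-+ f (suc m) n =
    trans (cong (_+_ (f 0)) (sumUpTo-+ (f ∘ suc) m n)) (sym (+-assoc (f 0) _ _))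

  length-filter-applyUpTo : ∀ {a p} {A : Set a} {P : Pred A p} (P? : Decidable P) f n →
    length (filter P? (applyUpTo f n)) ≡ sumUpTo (λ j → if does (P? (f j)) then 1 else 0) n
  length-filter-applyUpTo P? f zero = refl
  length-filter-applyUpTo P? f (suc n) with does (P? (f 0))
  ... | true  = cong suc (length-filter-applyUpTo P? (f ∘ suc) n)
  ... | false = length-filter-applyUpTo P? (f ∘ suc) n

  module _ (d : ℕ) .{{_ : NonZero d}} (i : ℕ) where

    residueIndicator : ℕ → ℕ
    residueIndicator a = if does (a % d ≟ i % d) then 1 else 0

    -- Number of entries ≡ i (mod d) in the k-th row of Stern's diatomic array generated by a and b (mediants
    -- inserted k times, the right end b excluded), computed with all entries reduced mod d.
    rowCount : ℕ → ℕ → ℕ → ℕ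
    rowCount zero    a b = residueIndicator a
    rowCount (suc k) a b = rowCount k a ((a + b) % d) + rowCount k ((a + b) % d) b

    rowCount-cong : ∀ k {a a′ b b′} → a % d ≡ a′ % d → b % d ≡ b′ % d →
                    rowCount k a b ≡ rowCount k a′ b′
    rowCount-cong zero a≡a′ _ = cong (λ r → if does (r ≟ i % d) then 1 else 0) a≡a′
    rowCount-cong (suc k) {a} {a′} {b} {b′} a≡a′ b≡b′ =
      cong₂ _+_ (rowCount-cong k a≡a′ mediant≡) (rowCount-cong k mediant≡ b≡b′)
      where
      open ≡-Reasoning
      mediant≡ : (a + b) % d % d ≡ (a′ + b′) % d % d
      mediant≡ = cong (_% d) (begin
        (a + b) % d              ≡⟨ %-distribˡ-+ a b d ⟩
        (a % d + b % d) % d      ≡⟨ cong₂ (λ x y → (x + y) % d) a≡a′ b≡b′ ⟩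
        (a′ % d + b′ % d) % d    ≡⟨ %-distribˡ-+ a′ b′ d ⟨
        (a′ + b′) % d            ∎)

    rowCount-block : ∀ k n →
      sumUpTo (λ j → residueIndicator (stern (2 ^ k * n + j))) (2 ^ k) ≡ rowCount k (stern n) (stern (suc n))
    rowCount-block zero n =
      trans (+-identityʳ _) (cong (residueIndicator ∘ stern) (trans (+-identityʳ _) (*-identityˡ n)))
    rowCount-block (suc k) n = begin
        sumUpTo f (A + (A + 0))
      ≡⟨ cong (sumUpTo f ∘ _+_ A) (+-identityʳ A) ⟩
        sumUpTo f (A + A)
      ≡⟨ sumUpTo-+ f A A ⟩
        sumUpTo f A + sumUpTo (λ j → f (A + j)) A
      ≡⟨ cong₂ _+_ (sumUpTo-cong (cong g ∘ first-half A n) A)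
                   (sumUpTo-cong (cong g ∘ second-half A n) A) ⟩
        sumUpTo (λ j → g (A * (n * 2) + j)) A + sumUpTo (λ j → g (A * suc (n * 2) + j)) A
      ≡⟨ cong₂ _+_ (rowCount-block k (n * 2)) (rowCount-block k (suc (n * 2))) ⟩
        rowCount k (stern (n * 2)) (stern (suc (n * 2)))
          + rowCount k (stern (suc (n * 2))) (stern (suc n * 2))
      ≡⟨ cong₂ _+_ (rowCount-cong k (cong (_% d) (stern-even n)) mediant)
                   (rowCount-cong k mediant (cong (_% d) (stern-even (suc n)))) ⟩
        rowCount (suc k) (stern n) (stern (suc n))
      ∎
      where
      open ≡-Reasoning
      A : ℕ
      A = 2 ^ k
      g f : ℕ → ℕ
      g = residueIndicator ∘ stern
      f j = g (2 ^ suc k * n + j)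
      first-half : ∀ a m j → 2 * a * m + j ≡ a * (m * 2) + j
      first-half = solve-∀
      second-half : ∀ a m j → 2 * a * m + (a + j) ≡ a * suc (m * 2) + j
      second-half = solve-∀
      mediant : stern (suc (n * 2)) % d ≡ (stern n + stern (suc n)) % d % d
      mediant = trans (cong (_% d) (stern-odd n)) (sym (m%n%n≡m%n _ d))

    T-sumUpTo : ∀ N → T N d i ≡ sumUpTo (residueIndicator ∘ stern) N
    T-sumUpTo = length-filter-applyUpTo (λ n → stern n % d ≟ i % d) id

    T-2^r≡rowCount : ∀ r → T (2 ^ r) d i ≡ rowCount r 0 1
    T-2^r≡rowCount r = begin
        T (2 ^ r) d i
      ≡⟨ T-sumUpTo (2 ^ r) ⟩
        sumUpTo (residueIndicator ∘ stern) (2 ^ r)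
      ≡⟨ sumUpTo-cong (λ j → cong (λ m → residueIndicator (stern (m + j))) (sym (*-zeroʳ (2 ^ r))))
                      (2 ^ r) ⟩
        sumUpTo (λ j → residueIndicator (stern (2 ^ r * 0 + j))) (2 ^ r)
      ≡⟨ rowCount-block r 0 ⟩
        rowCount r 0 1
      ∎
      where open ≡-Reasoning

module ClosedForm where

  open import Agda.Builtin.FromNat using (Number; fromNat)
  open import Agda.Builtin.FromNeg using (Negative; fromNeg)
  open import Data.Unit using (tt)  -- solves the ⊤ constraints of the literal instances
  open import Function using (_∘_)
  import Data.Nat.Literals as ℕ
  import Data.Nat as ℕ
  open import Data.Nat using (zero; suc)
  open import Data.Nat.Properties using (+-identityʳ)
  import Data.Integer as ℤ
  import Data.Integer.Properties as ℤ
  open import Data.Rational using (ℚ; _+_; _*_; _-_; ½; -½)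
  import Data.Rational.Literals as ℚ
  open import Data.Rational.Properties
    using (↥p/↧p≡p; *-assoc; *-zeroʳ; *-distribˡ-+; +-*-commutativeRing; _≟_)
  open import Data.Product using (_,_; proj₁; proj₂)
  open import Level using (0ℓ)
  open import Relation.Nullary.Decidable using (dec⇒maybe)
  open import Relation.Binary.PropositionalEquality
    using (refl; sym; trans; cong; cong₂; module ≡-Reasoning)
  open import Tactic.RingSolver using (solve-∀)
  open import Tactic.RingSolver.Core.AlmostCommutativeRing using (AlmostCommutativeRing; fromCommutativeRing)
  open SternBlocks using (rowCount)

  instance
    ℕ-number : Number ℕ
    ℕ-number = ℕ.number
    ℚ-number : Number ℚ
    ℚ-number = ℚ.number
    ℚ-negative : Negative ℚ
    ℚ-negative = ℚ.negative

  toℚ : ℕ → ℚ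
  toℚ n = + n / 1

  toℚ-+ : ∀ m n → toℚ (m ℕ.+ n) ≡ toℚ m + toℚ n
  toℚ-+ m n = begin
      toℚ (m ℕ.+ n)
    ≡⟨ cong (_/ 1) (cong₂ ℤ._+_ (ℤ.*-identityʳ (+ m)) (ℤ.*-identityʳ (+ n))) ⟨
      (+ m ℤ.* + 1 ℤ.+ + n ℤ.* + 1) / 1
    ≡⟨⟩
      ℚ.fromℤ (+ m) + ℚ.fromℤ (+ n)
    ≡⟨ cong₂ _+_ (↥p/↧p≡p (ℚ.fromℤ (+ m))) (↥p/↧p≡p (ℚ.fromℤ (+ n))) ⟨
      toℚ m + toℚ n
    ∎
    where open ≡-Reasoning

  toℚ-double : ∀ n → toℚ (2 ℕ.* n) ≡ toℚ n + toℚ n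
  toℚ-double n = trans (cong (toℚ ∘ ℕ._+_ n) (+-identityʳ n)) (toℚ-+ n n)

  ℚ-ring : AlmostCommutativeRing 0ℓ 0ℓ
  ℚ-ring = fromCommutativeRing +-*-commutativeRing (λ x → dec⇒maybe (0 ≟ x))

  -- μ ^ r = coord₀ r + coord₁ r * μ, because μ² = -2 - μ.
  coord₀ coord₁ : ℕ → ℚ
  coord₀ zero    = 1
  coord₀ (suc r) = -2 * coord₁ r
  coord₁ zero    = 0
  coord₁ (suc r) = coord₀ r - coord₁ r

  -- (-½ , s) is a root of X² + X + 2 exactly when s² = ¼; μ and μ̄ are the cases s = ± ½.
  root-pow : ∀ s → s * s ≡ + 1 / 4 → ∀ r → (-½ , s) ^Q r ≡ (coord₀ r - ½ * coord₁ r , s * coord₁ r)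
  root-pow s s²≡¼ zero    = cong (1 ,_) (sym (*-zeroʳ s))
  root-pow s s²≡¼ (suc r) rewrite root-pow s s²≡¼ r = cong₂ _,_ (begin
      -½ * (p - ½ * q) - 7 * (s * (s * q))
    ≡⟨ cong (λ y → -½ * (p - ½ * q) - 7 * y) (trans (sym (*-assoc s s q)) (cong (_* q) s²≡¼)) ⟩
      -½ * (p - ½ * q) - 7 * (+ 1 / 4 * q)
    ≡⟨ real p q ⟩
      -2 * q - ½ * (p - q)
    ∎) (imaginary s p q)
    where
    open ≡-Reasoning
    p q : ℚ
    p = coord₀ r
    q = coord₁ r
    real : ∀ p q → -½ * (p - ½ * q) - 7 * (+ 1 / 4 * q) ≡ -2 * q - ½ * (p - q)
    real = solve-∀ ℚ-ring
    imaginary : ∀ s p q → -½ * (s * q) + s * (p - ½ * q) ≡ s * (p - q)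
    imaginary = solve-∀ ℚ-ring

  μ-pow : ∀ r → μ ^Q r ≡ (coord₀ r - ½ * coord₁ r , ½ * coord₁ r)
  μ-pow = root-pow ½ refl

  μ̄-pow : ∀ r → μ̄ ^Q r ≡ (coord₀ r - ½ * coord₁ r , -½ * coord₁ r)
  μ̄-pow = root-pow -½ refl

  record HasClosedForm (r : ℕ) (α β γ : ℚ) (n : ℕ) : Set where
    constructor closedForm
    field
      four-times : 4 * toℚ n ≡ toℚ (2 ^ r) + α + β * coord₀ r + γ * coord₁ r

  -- β * coord₀ (suc r) + γ * coord₁ (suc r) = γ * coord₀ r + (-2 * β - γ) * coord₁ r.
  closedForm-+ : ∀ {r m n α₁ β₁ γ₁ α₂ β₂ γ₂ α β γ} →
    HasClosedForm r α₁ β₁ γ₁ m → HasClosedForm r α₂ β₂ γ₂ n →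
    α₁ + α₂ ≡ α → β₁ + β₂ ≡ γ → -2 * β - γ - γ₁ ≡ γ₂ →
    HasClosedForm (suc r) α β γ (m ℕ.+ n)
  closedForm-+ {r} {m} {n} {α₁} {β₁} {γ₁} {α₂} {β₂} {β = β} (closedForm hm) (closedForm hn) refl refl refl =
    closedForm (begin
        4 * toℚ (m ℕ.+ n)
      ≡⟨ cong (4 *_) (toℚ-+ m n) ⟩
        4 * (toℚ m + toℚ n)
      ≡⟨ *-distribˡ-+ 4 (toℚ m) (toℚ n) ⟩
        4 * toℚ m + 4 * toℚ n
      ≡⟨ cong₂ _+_ hm hn ⟩
        (x + α₁ + β₁ * p + γ₁ * q) + (x + α₂ + β₂ * p + (-2 * β - (β₁ + β₂) - γ₁) * q)
      ≡⟨ regroup x α₁ β₁ γ₁ α₂ β₂ β p q ⟩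
        (x + x) + (α₁ + α₂) + β * (-2 * q) + (β₁ + β₂) * (p - q)
      ≡⟨ cong (λ y → y + (α₁ + α₂) + β * (-2 * q) + (β₁ + β₂) * (p - q)) (toℚ-double (2 ^ r)) ⟨
        toℚ (2 ^ suc r) + (α₁ + α₂) + β * coord₀ (suc r) + (β₁ + β₂) * coord₁ (suc r)
      ∎)
    where
    open ≡-Reasoning
    x p q : ℚ
    x = toℚ (2 ^ r)
    p = coord₀ r
    q = coord₁ r
    regroup : ∀ x α₁ β₁ γ₁ α₂ β₂ β p q →
      (x + α₁ + β₁ * p + γ₁ * q) + (x + α₂ + β₂ * p + (-2 * β - (β₁ + β₂) - γ₁) * q)
        ≡ (x + x) + (α₁ + α₂) + β * (-2 * q) + (β₁ + β₂) * (p - q)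
    regroup = solve-∀ ℚ-ring

  -- The eight residue pairs other than (0 , 0) are closed under (a , b) ↦ (a , a + b), (a + b , b) mod 3.
  closedForm₁₀ : ∀ r → HasClosedForm r (-2) 1 0 (rowCount 3 0 r 1 0)
  closedForm₂₀ : ∀ r → HasClosedForm r (-2) 1 0 (rowCount 3 0 r 2 0)
  closedForm₀₁ : ∀ r → HasClosedForm r 2 1 0 (rowCount 3 0 r 0 1)
  closedForm₀₂ : ∀ r → HasClosedForm r 2 1 0 (rowCount 3 0 r 0 2)
  closedForm₁₁ : ∀ r → HasClosedForm r 0 (-1) (-2) (rowCount 3 0 r 1 1)
  closedForm₂₂ : ∀ r → HasClosedForm r 0 (-1) (-2) (rowCount 3 0 r 2 2)
  closedForm₁₂ : ∀ r → HasClosedForm r 0 (-1) 2 (rowCount 3 0 r 1 2)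
  closedForm₂₁ : ∀ r → HasClosedForm r 0 (-1) 2 (rowCount 3 0 r 2 1)

  closedForm₁₀ zero    = closedForm refl
  closedForm₁₀ (suc r) = closedForm-+ (closedForm₁₁ r) (closedForm₁₀ r) refl refl refl
  closedForm₂₀ zero    = closedForm refl
  closedForm₂₀ (suc r) = closedForm-+ (closedForm₂₂ r) (closedForm₂₀ r) refl refl refl
  closedForm₀₁ zero    = closedForm refl
  closedForm₀₁ (suc r) = closedForm-+ (closedForm₀₁ r) (closedForm₁₁ r) refl refl refl
  closedForm₀₂ zero    = closedForm refl
  closedForm₀₂ (suc r) = closedForm-+ (closedForm₀₂ r) (closedForm₂₂ r) refl refl refl
  closedForm₁₁ zero    = closedForm refl
  closedForm₁₁ (suc r) = closedForm-+ (closedForm₁₂ r) (closedForm₂₁ r) refl refl refl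
  closedForm₂₂ zero    = closedForm refl
  closedForm₂₂ (suc r) = closedForm-+ (closedForm₂₁ r) (closedForm₁₂ r) refl refl refl
  closedForm₁₂ zero    = closedForm refl
  closedForm₁₂ (suc r) = closedForm-+ (closedForm₁₀ r) (closedForm₀₂ r) refl refl refl
  closedForm₂₁ zero    = closedForm refl
  closedForm₂₁ (suc r) = closedForm-+ (closedForm₂₀ r) (closedForm₀₁ r) refl refl refl

  explicit-formula : ∀ {r n} → HasClosedForm r 2 1 0 n →
    ofℕ n ≡ ofℚ (+ 1 / 4) ⊗ ofℕ (2 ^ r)
              ⊕ c₁ ⊗ (coord₀ r - ½ * coord₁ r , ½ * coord₁ r)
              ⊕ c₂ ⊗ (coord₀ r - ½ * coord₁ r , -½ * coord₁ r)
              ⊕ ofℚ (+ 1 / 2)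
  explicit-formula {r} {n} (closedForm h) = cong₂ _,_ (begin
      toℚ n
    ≡⟨ quarter (toℚ n) ⟩
      + 1 / 4 * (4 * toℚ n)
    ≡⟨ cong (+ 1 / 4 *_) h ⟩
      + 1 / 4 * (toℚ (2 ^ r) + 2 + 1 * coord₀ r + 0 * coord₁ r)
    ≡⟨ real (toℚ (2 ^ r)) (coord₀ r) (coord₁ r) ⟩
      _
    ∎) (imaginary (toℚ (2 ^ r)) (coord₀ r) (coord₁ r))
    where
    open ≡-Reasoning
    quarter : ∀ t → t ≡ + 1 / 4 * (4 * t)
    quarter = solve-∀ ℚ-ring
    -- The right-hand sides are the two components of the formula as _⊗_ and _⊕_ compute them.
    real : ∀ x p q → + 1 / 4 * (x + 2 + 1 * p + 0 * q)
      ≡ + 1 / 4 * x - 7 * (0 * 0)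
        + (proj₁ c₁ * (p - ½ * q) - 7 * (proj₂ c₁ * (½ * q)))
        + (proj₁ c₂ * (p - ½ * q) - 7 * (proj₂ c₂ * (-½ * q)))
        + ½
    real = solve-∀ ℚ-ring
    imaginary : ∀ x p q → 0
      ≡ + 1 / 4 * 0 + 0 * x
        + (proj₁ c₁ * (½ * q) + proj₂ c₁ * (p - ½ * q))
        + (proj₁ c₂ * (-½ * q) + proj₂ c₂ * (p - ½ * q))
        + 0
    imaginary = solve-∀ ℚ-ring

open SternBlocks using (T-2^r≡rowCount)
open ClosedForm using (μ-pow; μ̄-pow; closedForm₀₁; explicit-formula)

corollary5p4 : (r : ℕ) →
    ofℕ (T (2 ^ r) 3 0)
      ≡ ofℚ (+ 1 / 4) ⊗ ofℕ (2 ^ r) ⊕ c₁ ⊗ (μ ^Q r) ⊕ c₂ ⊗ (μ̄ ^Q r) ⊕ ofℚ (+ 1 / 2)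
corollary5p4 r rewrite T-2^r≡rowCount 3 0 r | μ-pow r | μ̄-pow r = explicit-formula (closedForm₀₁ r)
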